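{- Let $p<q<r$ be primes and let $N>1$ be a small recurrent integer such that the four smallest elements of $S'_N$ are $p<q<p^2<r$. Then $|S'_N|\ne 4$ and $|S'_N|\ne 6$.
   Context: $S'_N=\{d:1<d<\sqrt N,\ d\mid N\}$. For $(u,v,a,b)\in\mathbb{Z}^4$, $U(u,v,a,b)$ is the sequence $n_1=u,n_2=v,n_i=an_{i-1}+bn_{i-2}$. $N$ is small recurrent if there are integers $a,b$ such that the elements $x_1<x_2<\cdots$ of $S'_N$ satisfy $x_i=ax_{i-1}+bx_{i-2}$ for all $i\ge3$ (vacuously true if $|S'_N|\le2$). -}

module Defs where

open import Data.Nat using (ℕ; zero; suc; _*_; _<_; _<?_)
open import Data.Nat.Divisibility using (_∣_; _∣?_)
open import Data.Integer as ℤ using (ℤ; +_)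
open import Data.List using (List; []; _∷_; filter; upTo; length)
open import Data.Product using (_×_; ∃₂)
open import Data.Unit using (⊤)
open import Relation.Binary.PropositionalEquality using (_≡_)
open import Relation.Nullary.Decidable using (_×-dec_)

-- S'_N = { d : 1 < d < √N , d ∣ N }, listed in increasing order.
-- (For natural d, d < √N  ⇔  d * d < N.)
S′ : ℕ → List ℕ
S′ N = filter (λ d → (1 <? d) ×-dec ((d * d <? N) ×-dec (d ∣? N))) (upTo N)

RecurrentList : ℤ → ℤ → List ℕ → Set
RecurrentList a b (x ∷ y ∷ z ∷ rest) =
  (+ z ≡ a ℤ.* (+ y) ℤ.+ b ℤ.* (+ x)) × RecurrentList a b (y ∷ z ∷ rest)
RecurrentList a b _ = ⊤

SmallRecurrent : ℕ → Set
SmallRecurrent N = ∃₂ λ (a b : ℤ) → RecurrentList a b (S′ N)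

-- Since p², q and r lie in S′ N and are pairwise coprime, N = K·p²qr for some K ≥ 1, and
-- pq = min(pq, Kpr) lies in S′ N above r, so |S′ N| ≥ 5.  For K = 1 a divisor of p²qr
-- in (r, √N) must be pq (a factor r would force it above √N, and the divisors of p²q
-- above r are pq and p²q), so |S′ N| = 5.  For K ≥ 2 the factor pairs (qr, p²K) and
-- (pr, pqK) of N contribute two more elements, so |S′ N| ≥ 7.
module Submission where

open import Defs
open import Data.Empty using (⊥)
open import Data.List using (List; []; _∷_; length; upTo)
open import Data.List.Membership.Propositional using (_∈_)
open import Data.List.Membership.Propositional.Properties using (∈-filter⁺; ∈-filter⁻; ∈-upTo⁺; ∈-length)
open import Data.List.Relation.Unary.All as All using (All; []; _∷_)
open import Data.List.Relation.Unary.AllPairs using (AllPairs; []; _∷_)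
import Data.List.Relation.Unary.AllPairs.Properties as AllPairs
open import Data.List.Relation.Unary.Any using (here; there)
open import Data.Nat using (ℕ; zero; suc; _+_; _*_; _^_; _<_; _≤_; _⊓_; _<?_; NonZero; >-nonZero; z≤n; z<s; s<s; n>1⇒nonTrivial; nonTrivial⇒n>1; nonTrivial⇒nonZero)
open import Data.Nat.Coprimality as Coprime using (Coprime; coprime-divisor; prime⇒coprime)
open import Data.Nat.Divisibility
open import Data.Nat.Primality
  using (Prime; _Rough_; prime⇒rough; prime⇒irreducible; prime⇒nonZero; prime⇒nonTrivial; euclidsLemma)
open import Data.Nat.Properties
open import Data.Nat.Tactic.RingSolver using (solve-∀)
open import Data.Product using (∃; ∃-syntax; _×_; _,_; proj₂)
open import Data.Sum using (_⊎_; inj₁; inj₂; [_,_]′)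
open import Function using (id; _∘_)
open import Relation.Binary using (tri<; tri≈; tri>)
open import Relation.Binary.PropositionalEquality
open import Relation.Nullary using (yes; no; contradiction)
open import Relation.Nullary.Decidable using (_×-dec_)

prime>1 : ∀ {p} → Prime p → 1 < p
prime>1 {p} p-prime = nonTrivial⇒n>1 p {{prime⇒nonTrivial p-prime}}

rough∧∣⇒≤ : ∀ {m n d} → m Rough n → d ∣ n → 1 < d → m ≤ d
rough∧∣⇒≤ rough d∣n 1<d =
  ≮⇒≥ λ d<m → rough (hasNonTrivialDivisor {{n>1⇒nonTrivial 1<d}} d<m d∣n)

prime⇒∤ : ∀ {p d} → Prime p → 1 < d → d < p → d ∤ p
prime⇒∤ p-prime 1<d d<p d∣p = <⇒≱ d<p (rough∧∣⇒≤ (prime⇒rough p-prime) d∣p 1<d)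

prime∤* : ∀ {s m n} → Prime s → s ∤ m → s ∤ n → s ∤ m * n
prime∤* {m = m} {n} s-prime s∤m s∤n s∣mn = [ s∤m , s∤n ]′ (euclidsLemma m n s-prime s∣mn)

rough-*-prime : ∀ {p m s} → Prime s → p ≤ s → p Rough m → p Rough (m * s)
rough-*-prime {m = m} {s} s-prime p≤s rough (hasNonTrivialDivisor {d} d<p d∣ms) =
  rough (hasNonTrivialDivisor d<p (coprime-divisor d⊥s (subst (d ∣_) (*-comm m s) d∣ms)))
  where
  d⊥s : Coprime d s
  d⊥s = Coprime.sym (prime⇒coprime s-prime {{nonTrivial⇒nonZero d}} (<-≤-trans d<p p≤s))

divisor-of-*-prime : ∀ {s d m} → Prime s → d ∣ m * s → d ∣ m ⊎ ∃[ e ] d ≡ e * s × e ∣ m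
divisor-of-*-prime {s} {d} {m} s-prime d∣ms with s ∣? d
... | yes (divides e refl) = inj₂ (e , refl , *-cancelʳ-∣ s {{prime⇒nonZero s-prime}} d∣ms)
... | no s∤d = inj₁ (coprime-divisor d⊥s (subst (d ∣_) (*-comm m s) d∣ms))
  where
  d⊥s : Coprime d s
  d⊥s (c∣d , c∣s) = [ id , (λ { refl → contradiction c∣d s∤d }) ]′ (prime⇒irreducible s-prime c∣s)

divisor-of-square-prime : ∀ {p d} → Prime p → d ∣ p * p → d ≡ 1 ⊎ d ≡ p ⊎ d ≡ p * p
divisor-of-square-prime p-prime d∣p² with divisor-of-*-prime p-prime d∣p²
... | inj₁ d∣p = [ inj₁ , inj₂ ∘ inj₁ ]′ (prime⇒irreducible p-prime d∣p)
... | inj₂ (e , refl , e∣p) with prime⇒irreducible p-prime e∣p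
...   | inj₁ refl = inj₂ (inj₁ (*-identityˡ _))
...   | inj₂ refl = inj₂ (inj₂ refl)

*-prime-∣ : ∀ {s m k} → Prime s → s ∤ m → m ∣ k → s ∣ k → m * s ∣ k
*-prime-∣ {s} {m} s-prime s∤m (divides a refl) s∣am with euclidsLemma a m s-prime s∣am
... | inj₂ s∣m = contradiction s∣m s∤m
... | inj₁ (divides b refl) = divides b (trans (*-assoc b s m) (cong (b *_) (*-comm s m)))

module _ {p q r : ℕ} (p-prime : Prime p) (q-prime : Prime q) (r-prime : Prime r) where

  private instance
    p≢0 : NonZero p
    p≢0 = prime⇒nonZero p-prime

  divisor-above-r≡p*q : ∀ {d} → p ≤ q → q < r → p * p < r → r < p * q →
    d ∣ p * p * q * r → r < d → d * d < p * p * q * r → d ≡ p * q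
  divisor-above-r≡p*q p≤q q<r p²<r r<pq d∣M r<d d²<M with divisor-of-*-prime r-prime d∣M
  ... | inj₂ (e , refl , e∣p²q) = contradiction d²<M (≤⇒≯ M≤d²)
    where
    1<e : 1 < e
    1<e = ≰⇒> λ e≤1 → <⇒≱ r<d (≤-trans (*-monoˡ-≤ r e≤1) (≤-reflexive (*-identityˡ r)))
    p≤e : p ≤ e
    p≤e = rough∧∣⇒≤ (rough-*-prime q-prime p≤q (rough-*-prime p-prime ≤-refl (prime⇒rough p-prime))) e∣p²q 1<e
    M≤d² : p * p * q * r ≤ e * r * (e * r)
    M≤d² = begin
      p * p * q * r   ≤⟨ *-monoˡ-≤ r (*-mono-≤ (*-mono-≤ p≤e p≤e) (<⇒≤ q<r)) ⟩
      e * e * r * r   ≡⟨ *-assoc (e * e) r r ⟩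
      e * e * (r * r) ≡⟨ [m*n]*[o*p]≡[m*o]*[n*p] e e r r ⟩
      e * r * (e * r) ∎
      where open ≤-Reasoning
  ... | inj₁ d∣p²q with divisor-of-*-prime q-prime d∣p²q
  ...   | inj₁ d∣p² = contradiction r<d (≤⇒≯ (≤-trans (∣⇒≤ {{m*n≢0 p p}} d∣p²) (<⇒≤ p²<r)))
  ...   | inj₂ (e , refl , e∣p²) with divisor-of-square-prime p-prime e∣p²
  ...     | inj₁ refl = contradiction r<d (<⇒≯ (subst (_< r) (sym (*-identityˡ q)) q<r))
  ...     | inj₂ (inj₁ refl) = refl
  ...     | inj₂ (inj₂ refl) =
            contradiction (*-cancelˡ-< (p * p * q) _ _ d²<M) (<⇒≯ (<-≤-trans r<pq (*-monoˡ-≤ q (m≤m*n p p))))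

⊓-preserves : ∀ (P : ℕ → Set) {x y} → P x → P y → P (x ⊓ y)
⊓-preserves P {x} {y} px py = [ (λ e → subst P (sym e) px) , (λ e → subst P (sym e) py) ]′ (⊓-sel x y)

∣∧∤⇒≢ : ∀ {d m n} → d ∣ m → d ∤ n → m ≢ n
∣∧∤⇒≢ d∣m d∤n refl = d∤n d∣m

sorted∧constant⇒length≤1 : ∀ {c} {xs : List ℕ} → AllPairs _<_ xs → All (_≡ c) xs → length xs ≤ 1
sorted∧constant⇒length≤1 []                  _                  = z≤n
sorted∧constant⇒length≤1 ([] ∷ [])           _                  = ≤-refl
sorted∧constant⇒length≤1 ((x<y ∷ _) ∷ _)     (refl ∷ refl ∷ _)  = contradiction x<y (<-irrefl refl)

length≡2⇒¬three-distinct : ∀ {A : Set} {a b c : A} (xs : List A) → length xs ≡ 2 →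
  a ∈ xs → b ∈ xs → c ∈ xs → a ≢ b → a ≢ c → b ≢ c → ⊥
length≡2⇒¬three-distinct (x ∷ y ∷ []) refl (here refl)         (here refl)         _                   a≢b _   _   = a≢b refl
length≡2⇒¬three-distinct (x ∷ y ∷ []) refl (there (here refl)) (there (here refl)) _                   a≢b _   _   = a≢b refl
length≡2⇒¬three-distinct (x ∷ y ∷ []) refl (here refl)         (there (here refl)) (here refl)         _   a≢c _   = a≢c refl
length≡2⇒¬three-distinct (x ∷ y ∷ []) refl (here refl)         (there (here refl)) (there (here refl)) _   _   b≢c = b≢c refl
length≡2⇒¬three-distinct (x ∷ y ∷ []) refl (there (here refl)) (here refl)         (here refl)         _   _   b≢c = b≢c refl
length≡2⇒¬three-distinct (x ∷ y ∷ []) refl (there (here refl)) (here refl)         (there (here refl)) _   a≢c _   = a≢c refl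

∈-S′⁻ : ∀ {N d} → d ∈ S′ N → 1 < d × d * d < N × d ∣ N
∈-S′⁻ {N} d∈ = proj₂ (∈-filter⁻ (λ d → (1 <? d) ×-dec ((d * d <? N) ×-dec (d ∣? N))) {xs = upTo N} d∈)

∈-S′⁺ : ∀ {N d} → 1 < d → d * d < N → d ∣ N → d ∈ S′ N
∈-S′⁺ {N} {d} 1<d d²<N d∣N =
  ∈-filter⁺ (λ d → (1 <? d) ×-dec ((d * d <? N) ×-dec (d ∣? N)))
    (∈-upTo⁺ (≤-<-trans (m≤m*n d d {{>-nonZero (<-trans z<s 1<d)}}) d²<N)) (1<d , d²<N , d∣N)

S′-sorted : ∀ N → AllPairs _<_ (S′ N)
S′-sorted N = AllPairs.filter⁺ _ (AllPairs.applyUpTo⁺₁ id N (λ i<j _ → i<j))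

factor-pair-∈-S′ : ∀ {N x y} → x * y ≡ N → 1 < x → x < y → x ∈ S′ N
factor-pair-∈-S′ {x = x} {y} xy≡N 1<x x<y =
  ∈-S′⁺ 1<x (subst (x * x <_) xy≡N (*-monoʳ-< x {{>-nonZero (<-trans z<s 1<x)}} x<y))
    (divides y (trans (sym xy≡N) (*-comm x y)))

⊓-∈-S′ : ∀ {N x y} → x * y ≡ N → 1 < x → 1 < y → x ≢ y → x ⊓ y ∈ S′ N
⊓-∈-S′ {N} {x} {y} xy≡N 1<x 1<y x≢y with <-cmp x y
... | tri< x<y _ _ = subst (_∈ S′ N) (sym (m≤n⇒m⊓n≡m (<⇒≤ x<y))) (factor-pair-∈-S′ xy≡N 1<x x<y)
... | tri≈ _ x≡y _ = contradiction x≡y x≢y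
... | tri> _ _ y<x =
  subst (_∈ S′ N) (sym (m≥n⇒m⊓n≡n (<⇒≤ y<x))) (factor-pair-∈-S′ (trans (*-comm y x) xy≡N) 1<y y<x)

p*q-cofactor : ∀ p q r K → p * q * (p * r * K) ≡ K * (p * p * q * r)
p*q-cofactor = solve-∀

q*r-cofactor : ∀ p q r K → q * r * (p * p * K) ≡ K * (p * p * q * r)
q*r-cofactor = solve-∀

p*r-cofactor : ∀ p q r K → p * r * (p * q * K) ≡ K * (p * p * q * r)
p*r-cofactor = solve-∀

module FourSmallest {p q r N : ℕ} {rest : List ℕ}
  (p-prime : Prime p) (q-prime : Prime q) (r-prime : Prime r) (p<q : p < q) (q<r : q < r)
  (1<N : 1 < N) (S′N≡ : S′ N ≡ p ∷ q ∷ p * p ∷ r ∷ rest) where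

  instance
    p≢0 : NonZero p
    p≢0 = prime⇒nonZero p-prime
    q≢0 : NonZero q
    q≢0 = prime⇒nonZero q-prime
    p²≢0 : NonZero (p * p)
    p²≢0 = m*n≢0 p p
    pq≢0 : NonZero (p * q)
    pq≢0 = m*n≢0 p q

  1<p : 1 < p
  1<p = prime>1 p-prime

  p<r : p < r
  p<r = <-trans p<q q<r

  p∤q : p ∤ q
  p∤q = prime⇒∤ q-prime 1<p p<q

  p∤r : p ∤ r
  p∤r = prime⇒∤ r-prime 1<p p<r

  q∤r : q ∤ r
  q∤r = prime⇒∤ r-prime (prime>1 q-prime) q<r

  p∤q*r : p ∤ q * r
  p∤q*r = prime∤* p-prime p∤q p∤r

  r∤p*q : r ∤ p * q
  r∤p*q = prime∤* r-prime (>⇒∤ p<r) (>⇒∤ q<r)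

  p²∤p* : ∀ {x} → p ∤ x → p * p ∤ p * x
  p²∤p* p∤x = p∤x ∘ *-cancelˡ-∣ p

  M : ℕ
  M = p * p * q * r

  sorted : AllPairs _<_ (p ∷ q ∷ p * p ∷ r ∷ rest)
  sorted = subst (AllPairs _<_) S′N≡ (S′-sorted N)

  q<p² : q < p * p
  q<p² with sorted
  ... | _ ∷ (q<p² ∷ _) ∷ _ = q<p²

  p²<r : p * p < r
  p²<r with sorted
  ... | _ ∷ _ ∷ (p²<r ∷ _) ∷ _ = p²<r

  r<rest : All (r <_) rest
  r<rest with sorted
  ... | _ ∷ _ ∷ _ ∷ r<rest ∷ _ = r<rest

  rest-sorted : AllPairs _<_ rest
  rest-sorted with sorted
  ... | _ ∷ _ ∷ _ ∷ _ ∷ rest-sorted = rest-sorted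

  listed⇒∈S′ : ∀ {x} → x ∈ p ∷ q ∷ p * p ∷ r ∷ rest → x ∈ S′ N
  listed⇒∈S′ {x} = subst (x ∈_) (sym S′N≡)

  listed⇒∣N : ∀ {x} → x ∈ p ∷ q ∷ p * p ∷ r ∷ rest → x ∣ N
  listed⇒∣N x∈ = proj₂ (proj₂ (∈-S′⁻ (listed⇒∈S′ x∈)))

  ∈-rest : ∀ {x} → x ∈ S′ N → p * p < x → x ≢ r → x ∈ rest
  ∈-rest {x} x∈S′ p²<x x≢r with subst (x ∈_) S′N≡ x∈S′
  ... | here refl                         = contradiction (<-trans p<q q<p²) (<-asym p²<x)
  ... | there (here refl)                 = contradiction q<p² (<-asym p²<x)
  ... | there (there (here refl))         = contradiction p²<x (<-irrefl refl)
  ... | there (there (there (here refl))) = contradiction refl x≢r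
  ... | there (there (there (there x∈)))  = x∈

  M∣N : M ∣ N
  M∣N = *-prime-∣ r-prime (prime∤* r-prime (prime∤* r-prime (>⇒∤ p<r) (>⇒∤ p<r)) (>⇒∤ q<r))
          (*-prime-∣ q-prime (prime∤* q-prime (>⇒∤ p<q) (>⇒∤ p<q))
            (listed⇒∣N (there (there (here refl)))) (listed⇒∣N (there (here refl))))
          (listed⇒∣N (there (there (there (here refl)))))

  cofactor : ∃[ k ] N ≡ suc k * M
  cofactor with M∣N
  ... | divides zero    N≡0 = contradiction (subst (1 <_) N≡0 1<N) λ ()
  ... | divides (suc k) N≡  = k , N≡

  1<p² : 1 < p * p
  1<p² = <-≤-trans 1<p (m≤m*n p p)

  p*q∈rest : p * q ∈ rest
  p*q∈rest with cofactor
  ... | k , N≡ = ∈-rest (factor-pair-∈-S′ (trans (p*q-cofactor p q r (suc k)) (sym N≡)) 1<pq pq<prK)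
                   (*-monoʳ-< p p<q) (∣∧∤⇒≢ (m∣m*n q) p∤r)
    where
    1<pq : 1 < p * q
    1<pq = <-trans 1<p² (*-monoʳ-< p p<q)
    pq<prK : p * q < p * r * suc k
    pq<prK = <-≤-trans (*-monoʳ-< p q<r) (m≤m*n (p * r) (suc k))

  N≡M⇒rest≡p*q : N ≡ 1 * M → All (_≡ p * q) rest
  N≡M⇒rest≡p*q N≡1*M = All.tabulate λ {d} d∈rest →
    let (_ , d²<N , d∣N) = ∈-S′⁻ (listed⇒∈S′ (there (there (there (there d∈rest)))))
    in divisor-above-r≡p*q p-prime q-prime r-prime (<⇒≤ p<q) q<r p²<r (All.lookup r<rest p*q∈rest)
         (subst (d ∣_) N≡M d∣N) (All.lookup r<rest d∈rest) (subst (d * d <_) N≡M d²<N)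
    where
    N≡M : N ≡ M
    N≡M = trans N≡1*M (*-identityˡ M)

  module ProperMultiple (k : ℕ) (N≡KM : N ≡ suc (suc k) * M) where

    K : ℕ
    K = suc (suc k)

    1<K : 1 < K
    1<K = s<s z<s

    p∣p²K : p ∣ p * p * K
    p∣p²K = ∣-trans (m∣m*n p) (m∣m*n K)

    p∣pqK : p ∣ p * q * K
    p∣pqK = ∣-trans (m∣m*n q) (m∣m*n K)

    p²<qr : p * p < q * r
    p²<qr = <-≤-trans p²<r (m≤n*m r q)

    p²<p²K : p * p < p * p * K
    p²<p²K = m<m*n (p * p) K 1<K

    p²<pr : p * p < p * r
    p²<pr = *-monoʳ-< p p<r

    p²<pqK : p * p < p * q * K
    p²<pqK = <-≤-trans (*-monoʳ-< p p<q) (m≤m*n (p * q) K)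

    A : ℕ
    A = (q * r) ⊓ (p * p * K)

    A∈rest : A ∈ rest
    A∈rest = ∈-rest
      (⊓-∈-S′ (trans (q*r-cofactor p q r K) (sym N≡KM)) (<-trans 1<p² p²<qr) (<-trans 1<p² p²<p²K)
        (≢-sym (∣∧∤⇒≢ p∣p²K p∤q*r)))
      (⊓-preserves (p * p <_) p²<qr p²<p²K)
      (⊓-preserves (_≢ r) (∣∧∤⇒≢ (m∣m*n r) q∤r) (∣∧∤⇒≢ p∣p²K p∤r))

    B : ℕ
    B = (p * r) ⊓ (p * q * K)

    B∈rest : B ∈ rest
    B∈rest = ∈-rest
      (⊓-∈-S′ (trans (p*r-cofactor p q r K) (sym N≡KM)) (<-trans 1<p² p²<pr) (<-trans 1<p² p²<pqK)
        (≢-sym (∣∧∤⇒≢ (∣-trans (n∣m*n p) (m∣m*n K)) (prime∤* q-prime (>⇒∤ p<q) q∤r))))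
      (⊓-preserves (p * p <_) p²<pr p²<pqK)
      (⊓-preserves (_≢ r) (∣∧∤⇒≢ (m∣m*n r) p∤r) (∣∧∤⇒≢ p∣pqK p∤r))

    A≢p*q : A ≢ p * q
    A≢p*q = ⊓-preserves (_≢ p * q) (∣∧∤⇒≢ (n∣m*n q) r∤p*q) (∣∧∤⇒≢ (m∣m*n K) (p²∤p* p∤q))

    B≢p*q : B ≢ p * q
    B≢p*q = ⊓-preserves (_≢ p * q) (∣∧∤⇒≢ (n∣m*n p) r∤p*q) (≢-sym (<⇒≢ (m<m*n (p * q) K 1<K)))

    A≢B : A ≢ B
    A≢B = ⊓-preserves (_≢ B)
      (⊓-preserves (q * r ≢_) (≢-sym (∣∧∤⇒≢ (m∣m*n r) p∤q*r)) (≢-sym (∣∧∤⇒≢ p∣pqK p∤q*r)))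
      (⊓-preserves (p * p * K ≢_) (∣∧∤⇒≢ (m∣m*n K) (p²∤p* p∤r)) (<⇒≢ (*-monoˡ-< K (*-monoʳ-< p p<q))))

    length-rest≢2 : length rest ≢ 2
    length-rest≢2 |rest|≡2 =
      length≡2⇒¬three-distinct rest |rest|≡2 p*q∈rest A∈rest B∈rest (≢-sym A≢p*q) (≢-sym B≢p*q) A≢B

  length-rest≢2 : length rest ≢ 2
  length-rest≢2 with cofactor
  ... | zero  , N≡M = λ |rest|≡2 →
          <⇒≱ (≤-reflexive (sym |rest|≡2)) (sorted∧constant⇒length≤1 rest-sorted (N≡M⇒rest≡p*q N≡M))
  ... | suc k , N≡KM = ProperMultiple.length-rest≢2 k N≡KM

proposition3p2 : (p q r N : ℕ) → Prime p → Prime q → Prime r →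
    p < q → q < r → 1 < N → SmallRecurrent N →
    (∃ λ (rest : List ℕ) → S′ N ≡ p ∷ q ∷ p ^ 2 ∷ r ∷ rest) →
    (length (S′ N) ≢ 4) × (length (S′ N) ≢ 6)
proposition3p2 p q r N p-prime q-prime r-prime p<q q<r 1<N _ (rest , S′N≡) =
    (λ |S′|≡4 → <⇒≢ (∈-length p*q∈rest) (sym (+-cancelˡ-≡ 4 _ _ (trans (sym |S′|≡4+|rest|) |S′|≡4))))
  , (λ |S′|≡6 → length-rest≢2 (+-cancelˡ-≡ 4 _ _ (trans (sym |S′|≡4+|rest|) |S′|≡6)))
  where
  open FourSmallest p-prime q-prime r-prime p<q q<r 1<N
         (subst (λ p² → S′ N ≡ p ∷ q ∷ p² ∷ r ∷ rest) (cong (p *_) (*-identityʳ p)) S′N≡)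
  |S′|≡4+|rest| : length (S′ N) ≡ 4 + length rest
  |S′|≡4+|rest| = cong length S′N≡
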